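{- Let $n\ge 1$ and let $G_n$ be a caterpillar graph with central path $P_n=v_1v_2\cdots v_n$ such that every vertex $v_i$ of $P_n$ satisfies $l(v_i)=1$. Then $\lambda_H(G_n)=\lceil n/2\rceil$.
   Context: A caterpillar graph $G_n$ is a tree containing a path $P_n$ on $n$ vertices (its central path) such that every vertex of $G_n$ is at distance at most $1$ from $P_n$; every vertex of $G_n$ not on $P_n$ is a leaf (vertex of degree $1$) adjacent to a vertex of $P_n$. For a vertex $v$, $l(v)$ denotes the number of leaves adjacent to $v$ (i.e. the number of pendant edges at $v$). For a graph $G$, the Hamiltonian complete number $\lambda_H(G)$ is the minimum number of edges not in $E(G)$, joining vertices of $G$, whose addition to $G$ produces a graph containing a Hamiltonian (spanning) cycle. -}

module Defs where

open import Data.Nat using (ℕ; zero; suc; _+_; _≤_; _∸_)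
open import Data.Fin using (Fin; toℕ)
open import Data.Sum using (_⊎_; inj₁; inj₂)
open import Data.Product using (Σ; _×_; _,_)
open import Data.Empty using (⊥)
open import Data.List using (List; length)
open import Data.List.Membership.Propositional using (_∈_)
open import Data.List.Relation.Unary.All using (All)
open import Relation.Nullary using (¬_)
open import Relation.Binary.PropositionalEquality using (_≡_; _≢_)
open import Function.Definitions using (Bijective)

HamiltonianCycle : {V : Set} → (N : ℕ) → (V → V → Set) → Set
HamiltonianCycle {V} N E =
  Σ (Fin N → V) λ σ →
    Bijective _≡_ _≡_ σ
    × 3 ≤ N
    × (∀ i j → suc (toℕ i) ≡ toℕ j → E (σ i) (σ j))
    × (∀ i j → toℕ i ≡ N ∸ 1 → toℕ j ≡ 0 → E (σ i) (σ j))

NewEdges : {V : Set} → (V → V → Set) → List (V × V) → Set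
NewEdges E F = All (λ { (u , v) → u ≢ v × ¬ E u v }) F

AddEdges : {V : Set} → (V → V → Set) → List (V × V) → V → V → Set
AddEdges E F u v = E u v ⊎ ((u , v) ∈ F ⊎ (v , u) ∈ F)

HamiltonianCompleteNumberIs : {V : Set} → (N : ℕ) → (V → V → Set) → ℕ → Set
HamiltonianCompleteNumberIs {V} N E k =
  (Σ (List (V × V)) λ F → length F ≡ k × NewEdges E F × HamiltonianCycle N (AddEdges E F))
  × (∀ (F : List (V × V)) → NewEdges E F → HamiltonianCycle N (AddEdges E F) → k ≤ length F)

-- The caterpillar G_n whose central path v_1 … v_n has l(v_i) = 1 for all i:
-- vertices inj₁ i = v_{i+1} (path vertices), inj₂ i = the leaf attached to v_{i+1}.
-- It has n + n vertices.
CatVertex : ℕ → Set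
CatVertex n = Fin n ⊎ Fin n

CatAdj : (n : ℕ) → CatVertex n → CatVertex n → Set
CatAdj n (inj₁ i) (inj₁ j) = (suc (toℕ i) ≡ toℕ j) ⊎ (suc (toℕ j) ≡ toℕ i)
CatAdj n (inj₁ i) (inj₂ j) = i ≡ j
CatAdj n (inj₂ i) (inj₁ j) = i ≡ j
CatAdj n (inj₂ i) (inj₂ j) = ⊥

{-# OPTIONS --safe #-}
-- Lower bound: a leaf of G_n has one neighbour in G_n but two in a Hamiltonian cycle, so each of the
-- n leaves is an endpoint of an added edge, and k added edges have at most 2k endpoints.
-- Upper bound: the tour ℓ₀ v₀ v₁ ℓ₁ ℓ₂ v₂ v₃ ℓ₃ ℓ₄ … crosses the rungs vₕℓₕ in order, in alternating
-- directions. Besides edges of G_n it uses the ⌊(n-1)/2⌋ bridges ℓ₁ℓ₂, ℓ₃ℓ₄, … and the closing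
-- edge back to ℓ₀: ⌈n/2⌉ new edges in total.
module Submission where

open import Defs
open import Data.Nat using (ℕ; zero; suc; _+_; _∸_; _≤_; _<_; z≤n; s≤s; z<s; ⌊_/2⌋; ⌈_/2⌉)
open import Data.Nat.Properties
open import Data.Fin using (Fin; zero; suc; toℕ; fromℕ; fromℕ<; inject₁; lower₁)
open import Data.Fin.Properties
  using ( toℕ-injective; toℕ-fromℕ; toℕ-fromℕ<; fromℕ<-injective; toℕ-inject₁; toℕ-lower₁
        ; toℕ<n; injective⇒≤)
open import Data.Sum using (_⊎_; inj₁; inj₂; swap)
open import Data.Sum.Properties using (inj₂-injective)
open import Data.Product using (Σ; ∃; ∃₂; _×_; _,_; proj₁; proj₂)
open import Data.List using (List; _∷_; _++_; length; map; lookup; tabulate)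
open import Data.List.Properties using (length-++; length-map; length-tabulate)
open import Data.List.Relation.Unary.Any using (here; there; index)
open import Data.List.Relation.Unary.Any.Properties using (lookup-index)
open import Data.List.Relation.Unary.All using (_∷_)
open import Data.List.Relation.Unary.All.Properties using (tabulate⁺)
open import Data.List.Membership.Propositional using (_∈_)
open import Data.List.Membership.Propositional.Properties
  using (∈-map⁺; ∈-++⁺ˡ; ∈-++⁺ʳ; ∈-tabulate⁺)
open import Function using (_∘_)
open import Function.Bundles using (mk↔ₛ′; Bijection)
open import Function.Definitions using (Injective; Bijective)
open import Function.Properties.Inverse using (↔⇒⤖)
open import Relation.Nullary using (¬_; yes; no; contradiction)
open import Relation.Binary.PropositionalEquality

private
  variable
    A V : Set
    k N : ℕ
    E R : V → V → Set

n+n≤m⇒n≤⌊m/2⌋ : ∀ {m n} → n + n ≤ m → n ≤ ⌊ m /2⌋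
n+n≤m⇒n≤⌊m/2⌋ {m} {n} n+n≤m = subst (_≤ ⌊ m /2⌋) (sym (n≡⌊n+n/2⌋ n)) (⌊n/2⌋-mono n+n≤m)

n≤⌊m/2⌋⇒n+n≤m : ∀ {m n} → n ≤ ⌊ m /2⌋ → n + n ≤ m
n≤⌊m/2⌋⇒n+n≤m {m} {n} n≤⌊m/2⌋ = begin
  n + n               ≤⟨ +-mono-≤ n≤⌊m/2⌋ (≤-trans n≤⌊m/2⌋ (⌊n/2⌋≤⌈n/2⌉ m)) ⟩
  ⌊ m /2⌋ + ⌈ m /2⌉   ≡⟨ ⌊n/2⌋+⌈n/2⌉≡n m ⟩
  m                   ∎
  where open ≤-Reasoning

m<n+n⇒⌊m/2⌋<n : ∀ {m n} → m < n + n → ⌊ m /2⌋ < n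
m<n+n⇒⌊m/2⌋<n m<n+n = ≰⇒> (<⇒≱ m<n+n ∘ n≤⌊m/2⌋⇒n+n≤m)

⌊m/2⌋<n⇒m<n+n : ∀ {m n} → ⌊ m /2⌋ < n → m < n + n
⌊m/2⌋<n⇒m<n+n ⌊m/2⌋<n = ≰⇒> (<⇒≱ ⌊m/2⌋<n ∘ n+n≤m⇒n≤⌊m/2⌋)

m≤n+n⇒⌈m/2⌉≤n : ∀ {m n} → m ≤ n + n → ⌈ m /2⌉ ≤ n
m≤n+n⇒⌈m/2⌉≤n {m} {n} m≤n+n = subst (⌈ m /2⌉ ≤_) (sym (n≡⌈n+n/2⌉ n)) (⌈n/2⌉-mono m≤n+n)

injective⇒≤length : ∀ {f : Fin k → A} {xs : List A} →
                    Injective _≡_ _≡_ f → (∀ i → f i ∈ xs) → k ≤ length xs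
injective⇒≤length {f = f} {xs} f-injective f∈xs = injective⇒≤ index-injective
  where
  index-injective : Injective _≡_ _≡_ (index ∘ f∈xs)
  index-injective {i} {j} eq = f-injective (begin
    f i                        ≡⟨ lookup-index (f∈xs i) ⟩
    lookup xs (index (f∈xs i)) ≡⟨ cong (lookup xs) eq ⟩
    lookup xs (index (f∈xs j)) ≡⟨ lookup-index (f∈xs j) ⟨
    f j                        ∎)
    where open ≡-Reasoning

endpoints : List (V × V) → List V
endpoints F = map proj₁ F ++ map proj₂ F

length-endpoints : ∀ (F : List (V × V)) → length (endpoints F) ≡ length F + length F
length-endpoints F =
  trans (length-++ (map proj₁ F)) (cong₂ _+_ (length-map proj₁ F) (length-map proj₂ F))

∈-endpoints : ∀ {F : List (V × V)} {u v} → (u , v) ∈ F ⊎ (v , u) ∈ F → u ∈ endpoints F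
∈-endpoints         (inj₁ uv∈F) = ∈-++⁺ˡ (∈-map⁺ proj₁ uv∈F)
∈-endpoints {F = F} (inj₂ vu∈F) = ∈-++⁺ʳ (map proj₁ F) (∈-map⁺ proj₂ vu∈F)

Consecutive : (N : ℕ) → Fin N → Fin N → Set
Consecutive N i j = suc (toℕ i) ≡ toℕ j ⊎ (toℕ i ≡ N ∸ 1 × toℕ j ≡ 0)

successor : (i : Fin N) → ∃ (Consecutive N i)
successor {suc M} i with toℕ i ≟ M
... | yes i≡M = zero , inj₂ (i≡M , refl)
... | no  i≢M = suc (lower₁ i (i≢M ∘ sym)) , inj₁ (cong suc (sym (toℕ-lower₁ i _)))

predecessor : (j : Fin N) → ∃ λ i → Consecutive N i j
predecessor {suc M} zero    = fromℕ M , inj₂ (toℕ-fromℕ M , refl)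
predecessor {suc M} (suc j) = inject₁ j , inj₁ (cong suc (toℕ-inject₁ j))

consecutive-asym : ∀ {i j : Fin N} → 3 ≤ N → Consecutive N i j → ¬ Consecutive N j i
consecutive-asym _ (inj₁ i→j) (inj₁ j→i) = <-asym (≤-reflexive i→j) (≤-reflexive j→i)
consecutive-asym (s≤s (s≤s (s≤s _))) (inj₁ i→j) (inj₂ (j≡last , i≡0)) =
  contradiction (trans (sym j≡last) (trans (sym i→j) (cong suc i≡0))) λ ()
consecutive-asym (s≤s (s≤s (s≤s _))) (inj₂ (i≡last , j≡0)) (inj₁ j→i) =
  contradiction (trans (sym i≡last) (trans (sym j→i) (cong suc j≡0))) λ ()
consecutive-asym (s≤s (s≤s (s≤s _))) (inj₂ (i≡last , _)) (inj₂ (_ , i≡0)) =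
  contradiction (trans (sym i≡last) i≡0) λ ()

hamiltonian⇒two-neighbours : HamiltonianCycle N R → ∀ v → ∃₂ λ u w → u ≢ w × R v u × R w v
hamiltonian⇒two-neighbours {R = R} (σ , (σ-injective , σ-surjective) , 3≤N , step , wrap) v
  with σ-surjective v
... | p , σ≡v with successor p | predecessor p
... | s , p→s | r , r→p =
  σ s , σ r , s≢r ∘ σ-injective ,
  subst (λ x → R x (σ s)) (σ≡v refl) (cycle-edge p→s) , subst (R (σ r)) (σ≡v refl) (cycle-edge r→p)
  where
  cycle-edge : ∀ {i j} → Consecutive _ i j → R (σ i) (σ j)
  cycle-edge (inj₁ i→j)            = step _ _ i→j
  cycle-edge (inj₂ (i≡last , j≡0)) = wrap _ _ i≡last j≡0
  s≢r : s ≢ r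
  s≢r s≡r = consecutive-asym 3≤N p→s (subst (λ x → Consecutive _ x p) (sym s≡r) r→p)

pendant∈endpoints : ∀ {F : List (V × V)} {v w} → HamiltonianCycle N (AddEdges E F) →
                    (∀ u → E v u ⊎ E u v → u ≡ w) → v ∈ endpoints F
pendant∈endpoints {E = E} {F = F} {v} cycle only-w
  with hamiltonian⇒two-neighbours {R = AddEdges E F} cycle v
... | _ , _ , _   , inj₂ vu∈F , _          = ∈-endpoints vu∈F
... | _ , _ , _   , _         , inj₂ u′v∈F = ∈-endpoints (swap u′v∈F)
... | u , u′ , u≢u′ , inj₁ Evu , inj₁ Eu′v =
  contradiction (trans (only-w u (inj₁ Evu)) (sym (only-w u′ (inj₂ Eu′v)))) u≢u′

leaf-unique-neighbour : ∀ {n} (j : Fin n) u → CatAdj n (inj₂ j) u ⊎ CatAdj n u (inj₂ j) → u ≡ inj₁ j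
leaf-unique-neighbour j (inj₁ _) (inj₁ refl) = refl
leaf-unique-neighbour j (inj₁ _) (inj₂ refl) = refl

lowerBound : ∀ n (F : List (CatVertex n × CatVertex n)) →
             HamiltonianCycle (n + n) (AddEdges (CatAdj n) F) → ⌈ n /2⌉ ≤ length F
lowerBound n F cycle = m≤n+n⇒⌈m/2⌉≤n (subst (n ≤_) (length-endpoints F)
  (injective⇒≤length inj₂-injective λ j →
    pendant∈endpoints {E = CatAdj n} cycle (leaf-unique-neighbour j)))

data Side : Set where
  spine leaf : Side

other : Side → Side
other spine = leaf
other leaf  = spine

other-involutive : ∀ s → other (other s) ≡ s
other-involutive spine = refl
other-involutive leaf  = refl

vertex : Side → Fin k → CatVertex k
vertex spine = inj₁
vertex leaf  = inj₂

rung-adjacent : ∀ s (i : Fin k) → CatAdj k (vertex s i) (vertex (other s) i)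
rung-adjacent spine i = refl
rung-adjacent leaf  i = refl

-- Position p of the tour lies on rung ⌊ p /2⌋, at the end given by side p.
side : ℕ → Side
side 0             = leaf
side 1             = spine
side (suc (suc p)) = other (side p)

position : Side → ℕ → ℕ
position s     (suc h) = suc (suc (position (other s) h))
position leaf  0       = 0
position spine 0       = 1

side-position : ∀ s h → side (position s h) ≡ s
side-position leaf  0       = refl
side-position spine 0       = refl
side-position s     (suc h) = trans (cong other (side-position (other s) h)) (other-involutive s)

⌊position/2⌋ : ∀ s h → ⌊ position s h /2⌋ ≡ h
⌊position/2⌋ leaf  0       = refl
⌊position/2⌋ spine 0       = refl
⌊position/2⌋ s     (suc h) = cong suc (⌊position/2⌋ (other s) h)

position-side : ∀ p → position (side p) ⌊ p /2⌋ ≡ p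
position-side 0             = refl
position-side 1             = refl
position-side (suc (suc p)) =
  cong (2 +_) (trans (cong (λ s → position s ⌊ p /2⌋) (other-involutive (side p)))
                     (position-side p))

-- The step from position p to p + 1; a leaf-step, from rung 2b+1 to rung 2b+2, is the one that
-- needs a new edge.
data Turn : Side → ℕ → Side → ℕ → Set where
  rung       : ∀ {s h} → Turn s h (other s) h
  spine-step : ∀ {h} → Turn spine h spine (suc h)
  leaf-step  : ∀ {b} → Turn leaf (b + suc b) leaf (suc b + suc b)

turn-shift : ∀ {s h s′ h′} → Turn s h s′ h′ →
             Turn (other (other s)) (suc (suc h)) (other (other s′)) (suc (suc h′))
turn-shift rung                = rung
turn-shift spine-step          = spine-step
turn-shift (leaf-step {b = b}) =
  subst (λ h → Turn leaf h leaf (suc h)) (+-suc (suc b) (suc b)) (leaf-step {b = suc b})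

turn : ∀ p → Turn (side p) ⌊ p /2⌋ (side (suc p)) ⌊ suc p /2⌋
turn 0                         = rung
turn 1                         = spine-step
turn 2                         = rung
turn 3                         = leaf-step {b = 0}
turn (suc (suc (suc (suc p)))) = turn-shift (turn p)

IsNewEdge : (V → V → Set) → V × V → Set
IsNewEdge E (u , v) = u ≢ v × ¬ E u v

leaves-isNewEdge : ∀ {x y : Fin k} → x ≢ y → IsNewEdge (CatAdj k) (inj₂ x , inj₂ y)
leaves-isNewEdge x≢y = x≢y ∘ inj₂-injective , λ ()

first-leaf-isNewEdge : ∀ s (i : Fin (suc k)) → 1 ≤ toℕ i →
                       IsNewEdge (CatAdj (suc k)) (vertex s i , inj₂ zero)
first-leaf-isNewEdge s     zero    ()
first-leaf-isNewEdge spine (suc i) _ = (λ ()) , (λ ())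
first-leaf-isNewEdge leaf  (suc i) _ = (λ ()) , (λ ())

module Tour (m : ℕ) where

  n : ℕ
  n = suc m

  visit : (p : ℕ) → .(p < n + n) → CatVertex n
  visit p p<2n = vertex (side p) (fromℕ< (m<n+n⇒⌊m/2⌋<n p<2n))

  visit-cong : ∀ {p q} → p ≡ q → .(p<2n : p < n + n) .(q<2n : q < n + n) →
               visit p p<2n ≡ visit q q<2n
  visit-cong refl _ _ = refl

  σ : Fin (n + n) → CatVertex n
  σ p = visit (toℕ p) (toℕ<n p)

  position<n+n : ∀ s (i : Fin n) → position s (toℕ i) < n + n
  position<n+n s i = ⌊m/2⌋<n⇒m<n+n (subst (_< n) (sym (⌊position/2⌋ s (toℕ i))) (toℕ<n i))

  place : Side → Fin n → Fin (n + n)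
  place s i = fromℕ< (position<n+n s i)

  σ⁻¹ : CatVertex n → Fin (n + n)
  σ⁻¹ (inj₁ i) = place spine i
  σ⁻¹ (inj₂ i) = place leaf i

  σ⁻¹-vertex : ∀ s i → σ⁻¹ (vertex s i) ≡ place s i
  σ⁻¹-vertex spine i = refl
  σ⁻¹-vertex leaf  i = refl

  σ-place : ∀ s i → σ (place s i) ≡ vertex s i
  σ-place s i = begin
    σ (place s i)                    ≡⟨ visit-cong (toℕ-fromℕ< _) (toℕ<n (place s i)) p<2n ⟩
    visit (position s (toℕ i)) p<2n  ≡⟨ cong₂ vertex (side-position s (toℕ i)) index≡i ⟩
    vertex s i                       ∎
    where
    open ≡-Reasoning
    p<2n : position s (toℕ i) < n + n
    p<2n = position<n+n s i
    index≡i : fromℕ< (m<n+n⇒⌊m/2⌋<n p<2n) ≡ i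
    index≡i = toℕ-injective (trans (toℕ-fromℕ< _) (⌊position/2⌋ s (toℕ i)))

  σ-σ⁻¹ : ∀ v → σ (σ⁻¹ v) ≡ v
  σ-σ⁻¹ (inj₁ i) = σ-place spine i
  σ-σ⁻¹ (inj₂ i) = σ-place leaf i

  σ⁻¹-σ : ∀ p → σ⁻¹ (σ p) ≡ p
  σ⁻¹-σ p = toℕ-injective (begin
    toℕ (σ⁻¹ (σ p))                            ≡⟨ cong toℕ (σ⁻¹-vertex (side (toℕ p)) _) ⟩
    toℕ (place (side (toℕ p)) (fromℕ< _))      ≡⟨ toℕ-fromℕ< _ ⟩
    position (side (toℕ p)) (toℕ (fromℕ< _))   ≡⟨ cong (position (side (toℕ p))) (toℕ-fromℕ< _) ⟩
    position (side (toℕ p)) ⌊ toℕ p /2⌋        ≡⟨ position-side (toℕ p) ⟩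
    toℕ p                                      ∎)
    where open ≡-Reasoning

  σ-bijective : Bijective _≡_ _≡_ σ
  σ-bijective = Bijection.bijective (↔⇒⤖ (mk↔ₛ′ σ σ⁻¹ σ-σ⁻¹ σ⁻¹-σ))

  bridge : ∀ b → .(suc b + suc b < n) → CatVertex n × CatVertex n
  bridge b lt = inj₂ (fromℕ< (<-trans (n<1+n (b + suc b)) lt)) , inj₂ (fromℕ< lt)

  bridge-cong : ∀ {b c} → b ≡ c → .(b-lt : suc b + suc b < n) .(c-lt : suc c + suc c < n) →
                bridge b b-lt ≡ bridge c c-lt
  bridge-cong refl _ _ = refl

  bridge-isNewEdge : ∀ b (lt : suc b + suc b < n) → IsNewEdge (CatAdj n) (bridge b lt)
  bridge-isNewEdge b lt =
    leaves-isNewEdge (1+n≢n ∘ sym ∘ fromℕ<-injective _ _ (<-trans (n<1+n (b + suc b)) lt) lt)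

  bridge-bound : (q : Fin ⌊ m /2⌋) → suc (toℕ q) + suc (toℕ q) < n
  bridge-bound q = s≤s (n≤⌊m/2⌋⇒n+n≤m (toℕ<n q))

  bridges : List (CatVertex n × CatVertex n)
  bridges = tabulate λ q → bridge (toℕ q) (bridge-bound q)

  bridge∈bridges : ∀ b (lt : suc b + suc b < n) → bridge b lt ∈ bridges
  bridge∈bridges b lt =
    subst (_∈ bridges) (bridge-cong (toℕ-fromℕ< b<⌊m/2⌋) (bridge-bound q) lt) (∈-tabulate⁺ q)
    where
    b<⌊m/2⌋ : b < ⌊ m /2⌋
    b<⌊m/2⌋ = n+n≤m⇒n≤⌊m/2⌋ (≤-pred lt)
    q : Fin ⌊ m /2⌋
    q = fromℕ< b<⌊m/2⌋

  -- m + n is the last position (n + n) ∸ 1.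
  closing : CatVertex n × CatVertex n
  closing = visit (m + n) ≤-refl , visit 0 z<s

  closing-isNewEdge : 2 ≤ m + n → IsNewEdge (CatAdj n) closing
  closing-isNewEdge 2≤m+n = first-leaf-isNewEdge (side (m + n)) _
    (subst (1 ≤_) (sym (toℕ-fromℕ< _)) (n+n≤m⇒n≤⌊m/2⌋ 2≤m+n))

  tourEdges : List (CatVertex n × CatVertex n)
  tourEdges = closing ∷ bridges

  Completed : CatVertex n → CatVertex n → Set
  Completed = AddEdges (CatAdj n) tourEdges

  turn-edge : ∀ {s h s′ h′} → Turn s h s′ h′ → (h<n : h < n) (h′<n : h′ < n) →
              Completed (vertex s (fromℕ< h<n)) (vertex s′ (fromℕ< h′<n))
  turn-edge {s = s} rung _ _       = inj₁ (rung-adjacent s _)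
  turn-edge spine-step h<n h′<n    =
    inj₁ (inj₁ (trans (cong suc (toℕ-fromℕ< h<n)) (sym (toℕ-fromℕ< h′<n))))
  turn-edge (leaf-step {b}) _ h′<n = inj₂ (inj₁ (there (bridge∈bridges b h′<n)))

  tour-step : ∀ i j → suc (toℕ i) ≡ toℕ j → Completed (σ i) (σ j)
  tour-step i j i→j = subst (Completed (σ i)) (visit-cong i→j next<2n (toℕ<n j))
    (turn-edge (turn (toℕ i)) (m<n+n⇒⌊m/2⌋<n (toℕ<n i)) (m<n+n⇒⌊m/2⌋<n next<2n))
    where
    next<2n : suc (toℕ i) < n + n
    next<2n = subst (_< n + n) (sym i→j) (toℕ<n j)

  tour-wrap : ∀ i j → toℕ i ≡ (n + n) ∸ 1 → toℕ j ≡ 0 → Completed (σ i) (σ j)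
  tour-wrap i j i≡last j≡0 = subst₂ Completed
    (visit-cong (sym i≡last) ≤-refl (toℕ<n i)) (visit-cong (sym j≡0) z<s (toℕ<n j))
    (inj₂ (inj₁ (here refl)))

  upperBound : 1 ≤ m → Σ (List (CatVertex n × CatVertex n)) λ F →
               length F ≡ ⌈ n /2⌉ × NewEdges (CatAdj n) F ×
               HamiltonianCycle (n + n) (AddEdges (CatAdj n) F)
  upperBound 1≤m =
    tourEdges ,
    cong suc (length-tabulate _) ,
    closing-isNewEdge 2≤m+n ∷ tabulate⁺ (λ q → bridge-isNewEdge (toℕ q) (bridge-bound q)) ,
    σ , σ-bijective , s≤s 2≤m+n , tour-step , tour-wrap
    where
    2≤m+n : 2 ≤ m + n
    2≤m+n = +-mono-≤ 1≤m (s≤s z≤n)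

mainTheorem1 : ∀ (n : ℕ) → 2 ≤ n → HamiltonianCompleteNumberIs {CatVertex n} (n + n) (CatAdj n) ⌈ n /2⌉
mainTheorem1 (suc m) (s≤s 1≤m) = Tour.upperBound m 1≤m , λ F _ → lowerBound (suc m) F
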